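{- For every fixed even positive integer $m$ there exists a constant $C_1(m)>0$ depending only on $m$ such that for every sufficiently large even integer $n$, $$\alpha(m,n)>C_1(m)\cdot\frac{\binom{m}{m/2}^n}{n^{\frac{m-1}{2}}}.$$
   Context: For positive integers $m,n$, let $A(m,n)$ be the set of all $m\times n$ matrices with every entry in $\{1,-1\}$ such that every row sum and every column sum has absolute value at most $1$, and let $\alpha(m,n)=|A(m,n)|$. -}

module Defs where

open import Data.Nat using (ℕ; zero; suc; _≤?_)
open import Data.Integer as ℤ using (ℤ; +_; -[1+_]; ∣_∣)
open import Data.List using (List; []; _∷_; concatMap; map; filter; length)
open import Data.Vec using (Vec; []; _∷_; foldr; transpose)
open import Data.Vec.Relation.Unary.All as VAll using (All)
open import Relation.Nullary using (Dec)
open import Relation.Nullary.Decidable using (_×-dec_)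
open import Data.Product using (_×_)
open import Data.Nat using (_≤_)

signs : List ℤ
signs = + 1 ∷ -[1+ 0 ] ∷ []

allVecs : {A : Set} → List A → (n : ℕ) → List (Vec A n)
allVecs xs zero = [] ∷ []
allVecs xs (suc n) = concatMap (λ x → map (x ∷_) (allVecs xs n)) xs

vsum : {n : ℕ} → Vec ℤ n → ℤ
vsum = foldr _ ℤ._+_ (+ 0)

SmallSum : {n : ℕ} → Vec ℤ n → Set
SmallSum v = ∣ vsum v ∣ ≤ 1

smallSum? : {n : ℕ} → (v : Vec ℤ n) → Dec (SmallSum v)
smallSum? v = ∣ vsum v ∣ ≤? 1

-- an m×n matrix (list of m rows, each of length n) belongs to A(m,n)
-- (entries are ±1 by construction of the enumeration below)
Balanced : {m n : ℕ} → Vec (Vec ℤ n) m → Set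
Balanced M = All SmallSum M × All SmallSum (transpose M)

balanced? : {m n : ℕ} → (M : Vec (Vec ℤ n) m) → Dec (Balanced M)
balanced? M = VAll.all? smallSum? M ×-dec VAll.all? smallSum? (transpose M)

allSignMatrices : (m n : ℕ) → List (Vec (Vec ℤ n) m)
allSignMatrices m n = allVecs (allVecs signs n) m

α : ℕ → ℕ → ℕ
α m n = length (filter balanced? (allSignMatrices m n))

-- Let S be the balanced ±1 columns of length m (entry sum 0), K = |S| = binom(m, m/2),
-- n = 2k, and for w ∈ S^k let colSum w ∈ ℤ^m be the sum of its k columns.
--  * Embedding: if colSum a = colSum b, the m × 2k matrix with columns a, −b lies in
--    A(m, n); so the number of such pairs (a, b) is at most α(m, n).
--  * Second moment: pairing c with −c in S, the parallelogram law gives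
--    Σ_w ‖colSum w‖² = k·m·K^k.
--  * Markov: with s = ⌊√(mn)⌋, at least half of the w are good, i.e. all entries of
--    colSum w except the first lie in [−s, s]; so K^k ≤ 2·#good.
--  * Collisions: colSum w is determined by these m−1 entries (its entries sum to 0),
--    which take at most R = (2s+1)^(m−1) values; by Cauchy–Schwarz #good² ≤ R·#pairs.
-- Hence K^(2k) ≤ 4·R·α(m,n); squaring and R² ≤ (9mn)^(m−1) gives the theorem with
-- p = 1, q = 32·(9m)^(m−1), N = 1.  The file develops finite sums and Cauchy–Schwarz,
-- integer vectors, counting of sign vectors, the second moment, the embedding, the
-- coding of boxes and Markov's inequality, and finally the arithmetic.

module Submission where

open import Defs
open import Data.Nat using (ℕ; zero; suc; _+_; _*_; _^_; _<_; _≤_; _∸_; ⌊_/2⌋; z≤n; s≤s; _≟_; _≤?_; NonZero)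
open import Data.Nat.Combinatorics using (_C_; nCk+nC[k+1]≡[n+1]C[k+1])
open import Data.Nat.Divisibility using (_∣_; divides)
open import Data.Nat.DivMod using (_%_; m<n⇒m%n≡m; [m+kn]%n≡m%n)
import Data.Nat.Properties as ℕₚ
open import Data.Nat.Tactic.RingSolver using (solve-∀)
open import Data.Integer as ℤ using (ℤ; +_; -[1+_]; ∣_∣)
import Data.Integer.Properties as ℤₚ
import Data.Integer.Tactic.RingSolver as ℤSolver
open import Data.Fin using (Fin)
open import Data.Product using (Σ; _×_; _,_; proj₁; proj₂)
open import Data.Sum using (inj₁; inj₂)
open import Data.Empty using (⊥; ⊥-elim)
open import Data.List as List using (List; []; _∷_; _++_; length; filter; concatMap; cartesianProduct; downFrom)
import Data.List.Properties as Listₚ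
open import Data.List.Relation.Unary.All as All using (All; []; _∷_)
import Data.List.Relation.Unary.Any as Any
open import Data.List.Relation.Unary.Any using (here; there)
open import Data.List.Relation.Unary.AllPairs using ([]; _∷_)
open import Data.List.Relation.Unary.Unique.Propositional using (Unique)
import Data.List.Relation.Unary.Unique.Propositional.Properties as Uniqueₚ
open import Data.List.Membership.Propositional using (_∈_; find)
import Data.List.Membership.Propositional.Properties as ∈ₚ
open import Data.Vec as Vec using (Vec; []; _∷_)
import Data.Vec.Properties as Vecₚ
open import Data.Vec.Relation.Unary.All as VecAll using ([]; _∷_)
import Data.Vec.Relation.Unary.All.Properties as VecAllₚ
open import Function using (_∘_)
open import Level using (0ℓ)
open import Relation.Binary.PropositionalEquality using (_≡_; _≢_; refl; sym; trans; cong; cong₂; subst; subst₂; module ≡-Reasoning)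
open import Relation.Nullary using (Dec; yes; no; ¬_)
open import Relation.Unary using (Pred; Decidable)

∑ : {A : Set} → List A → (A → ℕ) → ℕ
∑ []       f = 0
∑ (x ∷ xs) f = f x + ∑ xs f

∑-cong : ∀ {A : Set} {xs : List A} {f g : A → ℕ} → All (λ x → f x ≡ g x) xs → ∑ xs f ≡ ∑ xs g
∑-cong []       = refl
∑-cong (p ∷ ps) = cong₂ _+_ p (∑-cong ps)

∑-cong′ : ∀ {A : Set} (xs : List A) {f g : A → ℕ} → (∀ x → f x ≡ g x) → ∑ xs f ≡ ∑ xs g
∑-cong′ xs f≗g = ∑-cong (All.universal f≗g xs)

∑-mono : ∀ {A : Set} {xs : List A} {f g : A → ℕ} → All (λ x → f x ≤ g x) xs → ∑ xs f ≤ ∑ xs g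
∑-mono []       = z≤n
∑-mono (p ∷ ps) = ℕₚ.+-mono-≤ p (∑-mono ps)

∑-++ : ∀ {A : Set} (xs ys : List A) f → ∑ (xs ++ ys) f ≡ ∑ xs f + ∑ ys f
∑-++ []       ys f = refl
∑-++ (x ∷ xs) ys f = trans (cong (_+_ (f x)) (∑-++ xs ys f)) (sym (ℕₚ.+-assoc (f x) _ _))

∑-map : ∀ {A B : Set} (g : A → B) xs f → ∑ (List.map g xs) f ≡ ∑ xs (f ∘ g)
∑-map g []       f = refl
∑-map g (x ∷ xs) f = cong (_+_ (f (g x))) (∑-map g xs f)

∑-concatMap : ∀ {A B : Set} (g : A → List B) xs f → ∑ (concatMap g xs) f ≡ ∑ xs (λ x → ∑ (g x) f)
∑-concatMap g []       f = refl
∑-concatMap g (x ∷ xs) f = trans (∑-++ (g x) (concatMap g xs) f) (cong (_+_ (∑ (g x) f)) (∑-concatMap g xs f))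

∑-cartesianProduct : ∀ {A B : Set} (xs : List A) (ys : List B) f →
                     ∑ (cartesianProduct xs ys) f ≡ ∑ xs (λ a → ∑ ys (λ b → f (a , b)))
∑-cartesianProduct []       ys f = refl
∑-cartesianProduct (x ∷ xs) ys f = trans (∑-++ (List.map (x ,_) ys) (cartesianProduct xs ys) f)
  (cong₂ _+_ (∑-map (x ,_) ys f) (∑-cartesianProduct xs ys f))

∑-allVecs-suc : ∀ {A : Set} (xs : List A) n f →
                ∑ (allVecs xs (suc n)) f ≡ ∑ xs (λ x → ∑ (allVecs xs n) (λ v → f (x ∷ v)))
∑-allVecs-suc xs n f = trans (∑-concatMap _ xs f) (∑-cong′ xs (λ x → ∑-map (x ∷_) (allVecs xs n) f))

∑-+ : ∀ {A : Set} xs (f g : A → ℕ) → ∑ xs (λ x → f x + g x) ≡ ∑ xs f + ∑ xs g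
∑-+ []       f g = refl
∑-+ (x ∷ xs) f g = trans (cong (_+_ (f x + g x)) (∑-+ xs f g)) (interchange (f x) (g x) (∑ xs f) (∑ xs g))
  where
  interchange : ∀ a b c d → (a + b) + (c + d) ≡ (a + c) + (b + d)
  interchange = solve-∀

∑-const : ∀ {A : Set} (xs : List A) c → ∑ xs (λ _ → c) ≡ length xs * c
∑-const []       c = refl
∑-const (x ∷ xs) c = cong (_+_ c) (∑-const xs c)

∑-swap : ∀ {A B : Set} (xs : List A) (ys : List B) (f : A → B → ℕ) →
         ∑ xs (λ x → ∑ ys (f x)) ≡ ∑ ys (λ y → ∑ xs (λ x → f x y))
∑-swap []       ys f = sym (trans (∑-const ys 0) (ℕₚ.*-zeroʳ (length ys)))
∑-swap (x ∷ xs) ys f = trans (cong (_+_ (∑ ys (f x))) (∑-swap xs ys f))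
  (sym (∑-+ ys (f x) (λ y → ∑ xs (λ x → f x y))))

∑-*ˡ : ∀ {A : Set} c (xs : List A) f → c * ∑ xs f ≡ ∑ xs (λ x → c * f x)
∑-*ˡ c []       f = ℕₚ.*-zeroʳ c
∑-*ˡ c (x ∷ xs) f = trans (ℕₚ.*-distribˡ-+ c (f x) _) (cong (_+_ (c * f x)) (∑-*ˡ c xs f))

∑-product : ∀ {A : Set} (xs ys : List A) (f g : A → ℕ) → ∑ xs f * ∑ ys g ≡ ∑ xs (λ a → ∑ ys (λ b → f a * g b))
∑-product xs ys f g = trans (ℕₚ.*-comm (∑ xs f) _) (trans (∑-*ˡ (∑ ys g) xs f)
  (∑-cong′ xs (λ a → trans (ℕₚ.*-comm (∑ ys g) (f a)) (∑-*ˡ (f a) ys g))))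

𝟙 : {P : Set} → Dec P → ℕ
𝟙 (yes _) = 1
𝟙 (no  _) = 0

𝟙-cong : ∀ {P Q : Set} (p : Dec P) (q : Dec Q) → (P → Q) → (Q → P) → 𝟙 p ≡ 𝟙 q
𝟙-cong (yes _) (yes _) _ _ = refl
𝟙-cong (no  _) (no  _) _ _ = refl
𝟙-cong (yes p) (no ¬q) f _ = ⊥-elim (¬q (f p))
𝟙-cong (no ¬p) (yes q) _ g = ⊥-elim (¬p (g q))

∑-filter : ∀ {A : Set} {P : Pred A 0ℓ} (P? : Decidable P) xs f → ∑ (filter P? xs) f ≡ ∑ xs (λ x → 𝟙 (P? x) * f x)
∑-filter P? []       f = refl
∑-filter P? (x ∷ xs) f with P? x
... | yes _ = cong₂ _+_ (sym (ℕₚ.+-identityʳ (f x))) (∑-filter P? xs f)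
... | no  _ = ∑-filter P? xs f

∑-filter≤ : ∀ {A : Set} {P : Pred A 0ℓ} (P? : Decidable P) xs f → ∑ (filter P? xs) f ≤ ∑ xs f
∑-filter≤ P? []       f = z≤n
∑-filter≤ P? (x ∷ xs) f with P? x
... | yes _ = ℕₚ.+-monoʳ-≤ (f x) (∑-filter≤ P? xs f)
... | no  _ = ℕₚ.≤-trans (∑-filter≤ P? xs f) (ℕₚ.m≤n+m _ (f x))

length-filter : ∀ {A : Set} {P : Pred A 0ℓ} (P? : Decidable P) (xs : List A) → length (filter P? xs) ≡ ∑ xs (𝟙 ∘ P?)
length-filter P? []       = refl
length-filter P? (x ∷ xs) with P? x
... | yes _ = cong suc (length-filter P? xs)
... | no  _ = length-filter P? xs

δ : ℕ → ℕ → ℕ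
δ x y = 𝟙 (x ≟ y)

δ-sum-above : ∀ R x → R ≤ x → ∑ (downFrom R) (δ x) ≡ 0
δ-sum-above zero    x _   = refl
δ-sum-above (suc R) x R<x with x ≟ R
... | yes refl = ⊥-elim (ℕₚ.n≮n x R<x)
... | no  _    = δ-sum-above R x (ℕₚ.<⇒≤ R<x)

δ-sum : ∀ R x → x < R → ∑ (downFrom R) (δ x) ≡ 1
δ-sum (suc R) x x<1+R with x ≟ R
... | yes refl = cong suc (δ-sum-above R x ℕₚ.≤-refl)
... | no  x≢R  = δ-sum R x (ℕₚ.≤∧≢⇒< (ℕₚ.≤-pred x<1+R) x≢R)

δ-product : ∀ x y t → δ x t * δ y t ≡ δ x y * δ x t
δ-product x y t with x ≟ t | y ≟ t | x ≟ y
... | yes refl | yes refl | yes _   = refl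
... | yes refl | yes refl | no x≢x  = ⊥-elim (x≢x refl)
... | yes refl | no y≢x   | yes refl = ⊥-elim (y≢x refl)
... | yes refl | no _     | no _    = refl
... | no _     | _        | yes _   = refl
... | no _     | _        | no _    = refl

-- 2ab ≤ a² + b²; first for a ≤ b, where a² + (a+d)² = 2a(a+d) + d²
two-ab≤-ordered : ∀ a b → a ≤ b → 2 * (a * b) ≤ a * a + b * b
two-ab≤-ordered a b a≤b with ℕₚ.m≤n⇒∃[o]m+o≡n a≤b
... | d , refl = subst (2 * (a * (a + d)) ≤_) (sym (expand a d)) (ℕₚ.m≤m+n _ (d * d))
  where
  expand : ∀ a d → a * a + (a + d) * (a + d) ≡ 2 * (a * (a + d)) + d * d
  expand = solve-∀

two-ab≤ : ∀ a b → 2 * (a * b) ≤ a * a + b * b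
two-ab≤ a b with ℕₚ.≤-total a b
... | inj₁ a≤b = two-ab≤-ordered a b a≤b
... | inj₂ b≤a = subst₂ _≤_ (cong (2 *_) (ℕₚ.*-comm b a)) (ℕₚ.+-comm (b * b) (a * a)) (two-ab≤-ordered b a b≤a)

-- the inductive step of Cauchy–Schwarz: if A² ≤ R·B then 2xA ≤ B + R·x²
-- (multiply by R and use 2(Rx)A ≤ (Rx)² + A²)
cauchy-schwarz-step : ∀ R x A B → A * A ≤ R * B → 2 * (x * A) ≤ B + R * (x * x)
cauchy-schwarz-step zero      x zero    B _ = subst (_≤ B + 0) (cong (2 *_) (sym (ℕₚ.*-zeroʳ x))) z≤n
cauchy-schwarz-step R@(suc _) x A       B A²≤RB =
  ℕₚ.*-cancelˡ-≤ R (subst₂ _≤_ (scaleˡ R x A) (scaleʳ R x A B) bound)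
  where
  bound : 2 * ((R * x) * A) ≤ (R * x) * (R * x) + R * B
  bound = ℕₚ.≤-trans (two-ab≤ (R * x) A) (ℕₚ.+-monoʳ-≤ ((R * x) * (R * x)) A²≤RB)
  scaleˡ : ∀ R x A → 2 * ((R * x) * A) ≡ R * (2 * (x * A))
  scaleˡ = solve-∀
  scaleʳ : ∀ R x A B → (R * x) * (R * x) + R * B ≡ R * (B + R * (x * x))
  scaleʳ = solve-∀

cauchy-schwarz : ∀ R c → ∑ (downFrom R) c * ∑ (downFrom R) c ≤ R * ∑ (downFrom R) (λ t → c t * c t)
cauchy-schwarz zero    c = z≤n
cauchy-schwarz (suc R) c = subst₂ _≤_ (sym (square x A)) (regroup R x A B)
  (ℕₚ.+-mono-≤ (ℕₚ.+-monoʳ-≤ (x * x) (cauchy-schwarz-step R x A B IH)) IH)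
  where
  x : ℕ
  x = c R
  A : ℕ
  A = ∑ (downFrom R) c
  B : ℕ
  B = ∑ (downFrom R) (λ t → c t * c t)
  IH : A * A ≤ R * B
  IH = cauchy-schwarz R c
  square : ∀ x A → (x + A) * (x + A) ≡ (x * x + 2 * (x * A)) + A * A
  square = solve-∀
  regroup : ∀ R x A B → (x * x + (B + R * (x * x))) + R * B ≡ suc R * (x * x + B)
  regroup = solve-∀

-- Collision bound: if f maps the list G into {0,…,R-1}, then
--   |G|² ≤ R · #{(a,b) ∈ G² : f a = f b}
-- (Cauchy–Schwarz applied to the fibre sizes of f).
collision-bound : ∀ {A : Set} (G : List A) (f : A → ℕ) R → All (λ a → f a < R) G →
                  length G * length G ≤ R * ∑ G (λ a → ∑ G (λ b → δ (f a) (f b)))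
collision-bound G f R f<R =
  subst₂ _≤_ (cong₂ _*_ fibres-total fibres-total) (cong (R *_) fibres-squares) (cauchy-schwarz R fibre)
  where
  open ≡-Reasoning
  ts : List ℕ
  ts = downFrom R
  fibre : ℕ → ℕ
  fibre t = ∑ G (λ a → δ (f a) t)

  fibres-total : ∑ ts fibre ≡ length G
  fibres-total = begin
    ∑ ts fibre                  ≡⟨ ∑-swap ts G (λ t a → δ (f a) t) ⟩
    ∑ G (λ a → ∑ ts (δ (f a)))  ≡⟨ ∑-cong (All.map (λ {a} → δ-sum R (f a)) f<R) ⟩
    ∑ G (λ _ → 1)               ≡⟨ ∑-const G 1 ⟩
    length G * 1                ≡⟨ ℕₚ.*-identityʳ _ ⟩
    length G                    ∎

  coincidences : ∀ a → f a < R → ∑ ts (λ t → ∑ G (λ b → δ (f a) t * δ (f b) t)) ≡ ∑ G (λ b → δ (f a) (f b))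
  coincidences a fa<R = begin
    ∑ ts (λ t → ∑ G (λ b → δ (f a) t * δ (f b) t))     ≡⟨ ∑-swap ts G _ ⟩
    ∑ G (λ b → ∑ ts (λ t → δ (f a) t * δ (f b) t))     ≡⟨ ∑-cong′ G (λ b → ∑-cong′ ts (δ-product (f a) (f b))) ⟩
    ∑ G (λ b → ∑ ts (λ t → δ (f a) (f b) * δ (f a) t)) ≡⟨ ∑-cong′ G (λ b → sym (∑-*ˡ (δ (f a) (f b)) ts (δ (f a)))) ⟩
    ∑ G (λ b → δ (f a) (f b) * ∑ ts (δ (f a)))         ≡⟨ ∑-cong′ G (λ b → cong (δ (f a) (f b) *_) (δ-sum R (f a) fa<R)) ⟩
    ∑ G (λ b → δ (f a) (f b) * 1)                       ≡⟨ ∑-cong′ G (λ b → ℕₚ.*-identityʳ _) ⟩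
    ∑ G (λ b → δ (f a) (f b))                           ∎

  fibres-squares : ∑ ts (λ t → fibre t * fibre t) ≡ ∑ G (λ a → ∑ G (λ b → δ (f a) (f b)))
  fibres-squares = begin
    ∑ ts (λ t → fibre t * fibre t)
      ≡⟨ ∑-cong′ ts (λ t → ∑-product G G (λ a → δ (f a) t) (λ b → δ (f b) t)) ⟩
    ∑ ts (λ t → ∑ G (λ a → ∑ G (λ b → δ (f a) t * δ (f b) t)))
      ≡⟨ ∑-swap ts G _ ⟩
    ∑ G (λ a → ∑ ts (λ t → ∑ G (λ b → δ (f a) t * δ (f b) t)))
      ≡⟨ ∑-cong (All.map (λ {a} → coincidences a) f<R) ⟩
    ∑ G (λ a → ∑ G (λ b → δ (f a) (f b)))
      ∎

_⊞_ : ∀ {n} → Vec ℤ n → Vec ℤ n → Vec ℤ n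
_⊞_ = Vec.zipWith ℤ._+_

negate : ∀ {n} → Vec ℤ n → Vec ℤ n
negate = Vec.map (λ x → ℤ.- x)

negate-involutive : ∀ {n} (v : Vec ℤ n) → negate (negate v) ≡ v
negate-involutive []      = refl
negate-involutive (x ∷ v) = cong₂ _∷_ (ℤₚ.neg-involutive x) (negate-involutive v)

-- the sum of the vectors of a tuple, i.e. the row sums of the matrix with these columns
colSum : ∀ {m k} → Vec (Vec ℤ m) k → Vec ℤ m
colSum {m} []      = Vec.replicate m (+ 0)
colSum     (c ∷ w) = c ⊞ colSum w

vsum-⊞ : ∀ {n} (u v : Vec ℤ n) → vsum (u ⊞ v) ≡ vsum u ℤ.+ vsum v
vsum-⊞ []      []      = refl
vsum-⊞ (x ∷ u) (y ∷ v) = trans (cong (ℤ._+_ (x ℤ.+ y)) (vsum-⊞ u v)) (interchange x y (vsum u) (vsum v))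
  where
  interchange : ∀ a b c d → (a ℤ.+ b) ℤ.+ (c ℤ.+ d) ≡ (a ℤ.+ c) ℤ.+ (b ℤ.+ d)
  interchange = ℤSolver.solve-∀

vsum-++ : ∀ {n k} (u : Vec ℤ n) (v : Vec ℤ k) → vsum (u Vec.++ v) ≡ vsum u ℤ.+ vsum v
vsum-++ []      v = sym (ℤₚ.+-identityˡ _)
vsum-++ (x ∷ u) v = trans (cong (ℤ._+_ x) (vsum-++ u v)) (sym (ℤₚ.+-assoc x _ _))

vsum-negate : ∀ {n} (u : Vec ℤ n) → vsum (negate u) ≡ ℤ.- vsum u
vsum-negate []      = refl
vsum-negate (x ∷ u) = trans (cong (ℤ._+_ (ℤ.- x)) (vsum-negate u)) (sym (ℤₚ.neg-distrib-+ x (vsum u)))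

vsum-colSum : ∀ {m k} (w : Vec (Vec ℤ m) k) → VecAll.All (λ c → vsum c ≡ + 0) w → vsum (colSum w) ≡ + 0
vsum-colSum {m} [] [] = zeros m
  where
  zeros : ∀ m → vsum (Vec.replicate m (+ 0)) ≡ + 0
  zeros zero    = refl
  zeros (suc m) = trans (ℤₚ.+-identityˡ _) (zeros m)
vsum-colSum (c ∷ w) (c₀ ∷ w₀) = trans (vsum-⊞ c (colSum w)) (cong₂ ℤ._+_ c₀ (vsum-colSum w w₀))

zero-sum-tail-injective : ∀ {n} (u v : Vec ℤ (suc n)) → vsum u ≡ + 0 → vsum v ≡ + 0 →
                          Vec.tail u ≡ Vec.tail v → u ≡ v
zero-sum-tail-injective (x ∷ r) (y ∷ .r) u₀ v₀ refl = cong (_∷ r) (begin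
  x                         ≡⟨ cancel x (vsum r) ⟩
  (x ℤ.+ vsum r) ℤ.- vsum r ≡⟨ cong (ℤ._- vsum r) (trans u₀ (sym v₀)) ⟩
  (y ℤ.+ vsum r) ℤ.- vsum r ≡⟨ sym (cancel y (vsum r)) ⟩
  y                         ∎)
  where
  open ≡-Reasoning
  cancel : ∀ x r → x ≡ (x ℤ.+ r) ℤ.- r
  cancel = ℤSolver.solve-∀

sq : ℤ → ℕ
sq x = ∣ x ∣ * ∣ x ∣

sqNorm : ∀ {n} → Vec ℤ n → ℕ
sqNorm []      = 0
sqNorm (x ∷ v) = sq x + sqNorm v

+sq : ∀ x → + sq x ≡ x ℤ.* x
+sq (+ zero)  = refl
+sq (+ suc n) = refl
+sq -[1+ n ]  = refl

parallelogram₁ : ∀ x y → sq (x ℤ.+ y) + sq (ℤ.- x ℤ.+ y) ≡ 2 * (sq x + sq y)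
parallelogram₁ x y = ℤₚ.+-injective (begin
  + sq (x ℤ.+ y) ℤ.+ + sq (ℤ.- x ℤ.+ y)                          ≡⟨ cong₂ ℤ._+_ (+sq (x ℤ.+ y)) (+sq (ℤ.- x ℤ.+ y)) ⟩
  (x ℤ.+ y) ℤ.* (x ℤ.+ y) ℤ.+ (ℤ.- x ℤ.+ y) ℤ.* (ℤ.- x ℤ.+ y)   ≡⟨ expand x y ⟩
  (x ℤ.* x ℤ.+ y ℤ.* y) ℤ.+ (x ℤ.* x ℤ.+ y ℤ.* y)               ≡⟨ cong₂ (λ a b → (a ℤ.+ b) ℤ.+ (a ℤ.+ b)) (sym (+sq x)) (sym (+sq y)) ⟩
  + (sq x + sq y) ℤ.+ + (sq x + sq y)                             ≡⟨ cong (λ t → + (sq x + sq y + t)) (sym (ℕₚ.+-identityʳ _)) ⟩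
  + (2 * (sq x + sq y))                                           ∎)
  where
  open ≡-Reasoning
  expand : ∀ x y → (x ℤ.+ y) ℤ.* (x ℤ.+ y) ℤ.+ (ℤ.- x ℤ.+ y) ℤ.* (ℤ.- x ℤ.+ y) ≡ (x ℤ.* x ℤ.+ y ℤ.* y) ℤ.+ (x ℤ.* x ℤ.+ y ℤ.* y)
  expand = ℤSolver.solve-∀

parallelogram : ∀ {n} (c X : Vec ℤ n) → sqNorm (c ⊞ X) + sqNorm (negate c ⊞ X) ≡ 2 * (sqNorm c + sqNorm X)
parallelogram []      []      = refl
parallelogram (x ∷ c) (y ∷ X) = begin
  (sq (x ℤ.+ y) + sqNorm (c ⊞ X)) + (sq (ℤ.- x ℤ.+ y) + sqNorm (negate c ⊞ X))
    ≡⟨ interchange (sq (x ℤ.+ y)) _ _ _ ⟩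
  (sq (x ℤ.+ y) + sq (ℤ.- x ℤ.+ y)) + (sqNorm (c ⊞ X) + sqNorm (negate c ⊞ X))
    ≡⟨ cong₂ _+_ (parallelogram₁ x y) (parallelogram c X) ⟩
  2 * (sq x + sq y) + 2 * (sqNorm c + sqNorm X)
    ≡⟨ regroup (sq x) (sq y) (sqNorm c) (sqNorm X) ⟩
  2 * ((sq x + sqNorm c) + (sq y + sqNorm X))
    ∎
  where
  open ≡-Reasoning
  interchange : ∀ a b c d → (a + b) + (c + d) ≡ (a + c) + (b + d)
  interchange = solve-∀
  regroup : ∀ a b c d → 2 * (a + b) + 2 * (c + d) ≡ 2 * ((a + c) + (b + d))
  regroup = solve-∀

sqNorm-tail : ∀ {n} (v : Vec ℤ (suc n)) → sqNorm (Vec.tail v) ≤ sqNorm v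
sqNorm-tail (x ∷ v) = ℕₚ.m≤n+m (sqNorm v) (sq x)

sqNorm-large : ∀ s {n} (v : Vec ℤ n) → ¬ VecAll.All (λ y → ∣ y ∣ ≤ s) v → suc s * suc s ≤ sqNorm v
sqNorm-large s []      ¬small = ⊥-elim (¬small [])
sqNorm-large s (y ∷ v) ¬small with ∣ y ∣ ≤? s
... | yes y≤s = ℕₚ.≤-trans (sqNorm-large s v (λ v≤s → ¬small (y≤s ∷ v≤s))) (ℕₚ.m≤n+m (sqNorm v) (sq y))
... | no  y≰s = ℕₚ.≤-trans (ℕₚ.*-mono-≤ s<y s<y) (ℕₚ.m≤m+n (sq y) (sqNorm v))
  where
  s<y : suc s ≤ ∣ y ∣
  s<y = ℕₚ.≰⇒> y≰s

∈-allVecs⁻ : ∀ {A : Set} (xs : List A) n {v : Vec A n} → v ∈ allVecs xs n → VecAll.All (_∈ xs) v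
∈-allVecs⁻ xs zero    {[]}    _   = []
∈-allVecs⁻ xs (suc n) {y ∷ v} v∈ with find (∈ₚ.∈-concatMap⁻ (λ x → List.map (x ∷_) (allVecs xs n)) {xs = xs} v∈)
... | x , x∈ , y∷v∈ with ∈ₚ.∈-map⁻ (x ∷_) y∷v∈
...   | _ , v∈′ , refl = x∈ ∷ ∈-allVecs⁻ xs n v∈′

∈-allVecs⁺ : ∀ {A : Set} (xs : List A) n {v : Vec A n} → VecAll.All (_∈ xs) v → v ∈ allVecs xs n
∈-allVecs⁺ xs zero    []                 = here refl
∈-allVecs⁺ xs (suc n) {x ∷ v} (x∈ ∷ v∈) =
  ∈ₚ.∈-concatMap⁺ (λ y → List.map (y ∷_) (allVecs xs n)) (Any.map (λ { refl → ∈ₚ.∈-map⁺ (x ∷_) (∈-allVecs⁺ xs n v∈) }) x∈)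

length-allVecs : ∀ {A : Set} (xs : List A) n → length (allVecs xs n) ≡ length xs ^ n
length-allVecs xs zero    = refl
length-allVecs xs (suc n) = begin
  length (allVecs xs (suc n))                 ≡⟨ length-as-∑ (allVecs xs (suc n)) ⟩
  ∑ (allVecs xs (suc n)) (λ _ → 1)            ≡⟨ ∑-allVecs-suc xs n (λ _ → 1) ⟩
  ∑ xs (λ _ → ∑ (allVecs xs n) (λ _ → 1))     ≡⟨ ∑-cong′ xs (λ _ → sym (length-as-∑ (allVecs xs n))) ⟩
  ∑ xs (λ _ → length (allVecs xs n))          ≡⟨ ∑-const xs _ ⟩
  length xs * length (allVecs xs n)           ≡⟨ cong (length xs *_) (length-allVecs xs n) ⟩
  length xs * length xs ^ n                   ∎
  where
  open ≡-Reasoning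
  length-as-∑ : ∀ {B : Set} (ys : List B) → length ys ≡ ∑ ys (λ _ → 1)
  length-as-∑ ys = sym (trans (∑-const ys 1) (ℕₚ.*-identityʳ (length ys)))

allVecs-unique : ∀ {A : Set} (xs : List A) n → Unique xs → Unique (allVecs xs n)
allVecs-unique     xs zero    _       = [] ∷ []
allVecs-unique {A} xs (suc n) xs-uniq = go xs xs-uniq
  where
  prefixed : A → List (Vec A (suc n))
  prefixed x = List.map (x ∷_) (allVecs xs n)
  go : ∀ ys → Unique ys → Unique (concatMap prefixed ys)
  go []       _            = []
  go (y ∷ ys) (y∉ys ∷ ys-uniq) =
    Uniqueₚ.++⁺ (Uniqueₚ.map⁺ Vecₚ.∷-injectiveʳ (allVecs-unique xs n xs-uniq)) (go ys ys-uniq) disjoint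
    where
    disjoint : ∀ {v} → v ∈ prefixed y × v ∈ concatMap prefixed ys → ⊥
    disjoint (v∈y , v∈ys) with ∈ₚ.∈-map⁻ (y ∷_) v∈y | find (∈ₚ.∈-concatMap⁻ prefixed {xs = ys} v∈ys)
    ... | _ , _ , refl | y′ , y′∈ys , v∈y′ with ∈ₚ.∈-map⁻ (y′ ∷_) v∈y′
    ...   | _ , _ , y∷r≡y′∷r′ = All.lookup y∉ys y′∈ys (Vecₚ.∷-injectiveˡ y∷r≡y′∷r′)

∑-signs-negate : ∀ n F → ∑ (allVecs signs n) F ≡ ∑ (allVecs signs n) (F ∘ negate)
∑-signs-negate zero    F = refl
∑-signs-negate (suc n) F = begin
  ∑ (allVecs signs (suc n)) F
    ≡⟨ ∑-allVecs-suc signs n F ⟩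
  ∑ V (λ v → F (+ 1 ∷ v)) + (∑ V (λ v → F (-[1+ 0 ] ∷ v)) + 0)
    ≡⟨ cong₂ (λ a b → a + (b + 0)) (∑-signs-negate n (λ v → F (+ 1 ∷ v))) (∑-signs-negate n (λ v → F (-[1+ 0 ] ∷ v))) ⟩
  ∑ V (λ v → F (+ 1 ∷ negate v)) + (∑ V (λ v → F (-[1+ 0 ] ∷ negate v)) + 0)
    ≡⟨ swap (∑ V (λ v → F (+ 1 ∷ negate v))) _ ⟩
  ∑ V (λ v → F (-[1+ 0 ] ∷ negate v)) + (∑ V (λ v → F (+ 1 ∷ negate v)) + 0)
    ≡⟨ sym (∑-allVecs-suc signs n (F ∘ negate)) ⟩
  ∑ (allVecs signs (suc n)) (F ∘ negate)
    ∎
  where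
  open ≡-Reasoning
  V : List (Vec ℤ n)
  V = allVecs signs n
  swap : ∀ a b → a + (b + 0) ≡ b + (a + 0)
  swap = solve-∀

unique-length≤ : ∀ {A : Set} (xs ys : List A) → Unique xs → All (_∈ ys) xs → length xs ≤ length ys
unique-length≤ []       ys _               _              = z≤n
unique-length≤ (x ∷ xs) ys (x∉xs ∷ xs-uniq) (x∈ys ∷ xs⊆ys) with ∈ₚ.∈-∃++ x∈ys
... | ys₁ , ys₂ , refl = subst (suc (length xs) ≤_) (sym length-ys)
  (s≤s (unique-length≤ xs (ys₁ ++ ys₂) xs-uniq (All.tabulate (λ {z} z∈xs → keep (All.lookup xs⊆ys z∈xs) (≢x z∈xs)))))
  where
  length-ys : length (ys₁ ++ x ∷ ys₂) ≡ suc (length (ys₁ ++ ys₂))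
  length-ys = trans (Listₚ.length-++ ys₁) (trans (ℕₚ.+-suc (length ys₁) (length ys₂)) (cong suc (sym (Listₚ.length-++ ys₁))))
  ≢x : ∀ {z} → z ∈ xs → z ≢ x
  ≢x z∈xs z≡x = All.lookup x∉xs z∈xs (sym z≡x)
  keep : ∀ {z} → z ∈ ys₁ ++ x ∷ ys₂ → z ≢ x → z ∈ ys₁ ++ ys₂
  keep z∈ z≢x with ∈ₚ.∈-++⁻ ys₁ z∈
  ... | inj₁ z∈ys₁         = ∈ₚ.∈-++⁺ˡ z∈ys₁
  ... | inj₂ (here z≡x)    = ⊥-elim (z≢x z≡x)
  ... | inj₂ (there z∈ys₂) = ∈ₚ.∈-++⁺ʳ ys₁ z∈ys₂

zeroSum? : ∀ {m} (v : Vec ℤ m) → Dec (vsum v ≡ + 0)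
zeroSum? v = vsum v ℤ.≟ + 0

balancedCols : (m : ℕ) → List (Vec ℤ m)
balancedCols m = filter zeroSum? (allVecs signs m)

BalancedCol : ∀ {m} → Vec ℤ m → Set
BalancedCol c = VecAll.All (_∈ signs) c × vsum c ≡ + 0

∈-balancedCols⁻ : ∀ {m c} → c ∈ balancedCols m → BalancedCol c
∈-balancedCols⁻ {m} c∈ with ∈ₚ.∈-filter⁻ zeroSum? {xs = allVecs signs m} c∈
... | c∈all , c₀ = ∈-allVecs⁻ signs m c∈all , c₀

negate-zeroSum : ∀ {m} (v : Vec ℤ m) → vsum v ≡ + 0 → vsum (negate v) ≡ + 0
negate-zeroSum v v₀ = trans (vsum-negate v) (cong (λ t → ℤ.- t) v₀)

negate-balanced : ∀ {m} {c : Vec ℤ m} → BalancedCol c → BalancedCol (negate c)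
negate-balanced {c = c} (c±1 , c₀) = VecAllₚ.map⁺ (VecAll.map negate-sign c±1) , negate-zeroSum c c₀
  where
  negate-sign : ∀ {x} → x ∈ signs → ℤ.- x ∈ signs
  negate-sign (here refl)         = there (here refl)
  negate-sign (there (here refl)) = here refl

sqNorm-signs : ∀ {n} {v : Vec ℤ n} → VecAll.All (_∈ signs) v → sqNorm v ≡ n
sqNorm-signs []                        = refl
sqNorm-signs (here refl         ∷ v±1) = cong suc (sqNorm-signs v±1)
sqNorm-signs (there (here refl) ∷ v±1) = cong suc (sqNorm-signs v±1)

∑-balanced-negate : ∀ m g → ∑ (balancedCols m) g ≡ ∑ (balancedCols m) (g ∘ negate)
∑-balanced-negate m g = begin
  ∑ (balancedCols m) g                                 ≡⟨ ∑-filter zeroSum? V g ⟩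
  ∑ V (λ v → 𝟙 (zeroSum? v) * g v)                     ≡⟨ ∑-signs-negate m _ ⟩
  ∑ V (λ v → 𝟙 (zeroSum? (negate v)) * g (negate v))   ≡⟨ ∑-cong′ V (λ v → cong (_* g (negate v)) (same-indicator v)) ⟩
  ∑ V (λ v → 𝟙 (zeroSum? v) * g (negate v))            ≡⟨ sym (∑-filter zeroSum? V (g ∘ negate)) ⟩
  ∑ (balancedCols m) (g ∘ negate)                      ∎
  where
  open ≡-Reasoning
  V : List (Vec ℤ m)
  V = allVecs signs m
  same-indicator : ∀ v → 𝟙 (zeroSum? (negate v)) ≡ 𝟙 (zeroSum? v)
  same-indicator v = 𝟙-cong _ _
    (λ v₀ → subst (λ u → vsum u ≡ + 0) (negate-involutive v) (negate-zeroSum (negate v) v₀))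
    (negate-zeroSum v)

-- Σ_{c balanced} ‖c + X‖² = |S|·(m + ‖X‖²): pairing c with −c, the parallelogram
-- law removes the cross terms
∑-balanced-shift : ∀ m (X : Vec ℤ m) →
                   ∑ (balancedCols m) (λ c → sqNorm (c ⊞ X)) ≡ length (balancedCols m) * (m + sqNorm X)
∑-balanced-shift m X = ℕₚ.*-cancelˡ-≡ _ _ 2 (begin
  2 * ∑ S f                                ≡⟨ double (∑ S f) ⟩
  ∑ S f + ∑ S f                            ≡⟨ cong (_+_ (∑ S f)) (∑-balanced-negate m f) ⟩
  ∑ S f + ∑ S (f ∘ negate)                 ≡⟨ sym (∑-+ S f (f ∘ negate)) ⟩
  ∑ S (λ c → f c + f (negate c))           ≡⟨ ∑-cong (All.tabulate (λ c∈ → pair (∈-balancedCols⁻ c∈))) ⟩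
  ∑ S (λ _ → 2 * (m + sqNorm X))           ≡⟨ ∑-const S _ ⟩
  length S * (2 * (m + sqNorm X))          ≡⟨ swap (length S) (m + sqNorm X) ⟩
  2 * (length S * (m + sqNorm X))          ∎)
  where
  open ≡-Reasoning
  S : List (Vec ℤ m)
  S = balancedCols m
  f : Vec ℤ m → ℕ
  f c = sqNorm (c ⊞ X)
  pair : ∀ {c} → BalancedCol c → f c + f (negate c) ≡ 2 * (m + sqNorm X)
  pair {c} (c±1 , _) = trans (parallelogram c X) (cong (λ t → 2 * (t + sqNorm X)) (sqNorm-signs c±1))
  double : ∀ a → 2 * a ≡ a + a
  double = solve-∀
  swap : ∀ a b → a * (2 * b) ≡ 2 * (a * b)
  swap = solve-∀

signCount : ℕ → ℤ → ℕ
signCount n t = ∑ (allVecs signs n) (λ v → 𝟙 (vsum v ℤ.≟ t))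

𝟙-shift : ∀ x a t → 𝟙 (x ℤ.+ a ℤ.≟ t) ≡ 𝟙 (a ℤ.≟ t ℤ.+ ℤ.- x)
𝟙-shift x a t = 𝟙-cong _ _ (to x a t) (from x a t)
  where
  to : ∀ x a t → x ℤ.+ a ≡ t → a ≡ t ℤ.+ ℤ.- x
  to x a _ refl = cancel x a
    where
    cancel : ∀ x a → a ≡ (x ℤ.+ a) ℤ.+ ℤ.- x
    cancel = ℤSolver.solve-∀
  from : ∀ x a t → a ≡ t ℤ.+ ℤ.- x → x ℤ.+ a ≡ t
  from x _ t refl = cancel x t
    where
    cancel : ∀ x t → x ℤ.+ (t ℤ.+ ℤ.- x) ≡ t
    cancel = ℤSolver.solve-∀

signCount-suc : ∀ n t → signCount (suc n) t ≡ signCount n (t ℤ.+ -[1+ 0 ]) + signCount n (t ℤ.+ + 1)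
signCount-suc n t = begin
  signCount (suc n) t
    ≡⟨ ∑-allVecs-suc signs n _ ⟩
  ∑ V (λ v → 𝟙 (+ 1 ℤ.+ vsum v ℤ.≟ t)) + (∑ V (λ v → 𝟙 (-[1+ 0 ] ℤ.+ vsum v ℤ.≟ t)) + 0)
    ≡⟨ cong₂ (λ a b → a + (b + 0)) (∑-cong′ V (λ v → 𝟙-shift (+ 1) (vsum v) t))
                                   (∑-cong′ V (λ v → 𝟙-shift -[1+ 0 ] (vsum v) t)) ⟩
  signCount n (t ℤ.+ -[1+ 0 ]) + (signCount n (t ℤ.+ + 1) + 0)
    ≡⟨ cong (_+_ (signCount n (t ℤ.+ -[1+ 0 ]))) (ℕₚ.+-identityʳ _) ⟩
  signCount n (t ℤ.+ -[1+ 0 ]) + signCount n (t ℤ.+ + 1)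
    ∎
  where
  open ≡-Reasoning
  V : List (Vec ℤ n)
  V = allVecs signs n

signCount-above : ∀ n d → signCount n (+ (n + suc d)) ≡ 0
signCount-above zero    d = refl
signCount-above (suc n) d = trans (signCount-suc n _) (cong₂ _+_
  (signCount-above n d)
  (trans (cong (signCount n ∘ +_) (shift n d)) (signCount-above n (suc (suc d)))))
  where
  shift : ∀ n d → suc n + suc d + 1 ≡ n + suc (suc (suc d))
  shift = solve-∀

-- N(n, n − 2j) = binom(n, j): choose the j entries equal to −1
signCount-binomial : ∀ n j → signCount n (+ n ℤ.+ ℤ.- (+ j ℤ.+ + j)) ≡ n C j
signCount-binomial zero    zero    = refl
signCount-binomial zero    (suc j) = refl
signCount-binomial (suc n) zero    = trans (signCount-suc n _) (cong₂ _+_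
  (trans (cong (signCount n) (down (+ n))) (signCount-binomial n 0))
  (trans (cong (signCount n) (trans (up (+ n)) (cong +_ (ℕₚ.+-comm 2 n)))) (signCount-above n 1)))
  where
  down : ∀ a → (+ 1 ℤ.+ a) ℤ.+ ℤ.- (+ 0 ℤ.+ + 0) ℤ.+ -[1+ 0 ] ≡ a ℤ.+ ℤ.- (+ 0 ℤ.+ + 0)
  down = ℤSolver.solve-∀
  up : ∀ a → (+ 1 ℤ.+ a) ℤ.+ ℤ.- (+ 0 ℤ.+ + 0) ℤ.+ + 1 ≡ + 2 ℤ.+ a
  up = ℤSolver.solve-∀
signCount-binomial (suc n) (suc j) = begin
  signCount (suc n) (+ suc n ℤ.+ ℤ.- (+ suc j ℤ.+ + suc j))
    ≡⟨ signCount-suc n _ ⟩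
  signCount n (+ suc n ℤ.+ ℤ.- (+ suc j ℤ.+ + suc j) ℤ.+ -[1+ 0 ]) + signCount n (+ suc n ℤ.+ ℤ.- (+ suc j ℤ.+ + suc j) ℤ.+ + 1)
    ≡⟨ cong₂ (λ a b → signCount n a + signCount n b) (down (+ n) (+ j)) (up (+ n) (+ j)) ⟩
  signCount n (+ n ℤ.+ ℤ.- (+ suc j ℤ.+ + suc j)) + signCount n (+ n ℤ.+ ℤ.- (+ j ℤ.+ + j))
    ≡⟨ cong₂ _+_ (signCount-binomial n (suc j)) (signCount-binomial n j) ⟩
  n C suc j + n C j
    ≡⟨ ℕₚ.+-comm (n C suc j) (n C j) ⟩
  n C j + n C suc j
    ≡⟨ nCk+nC[k+1]≡[n+1]C[k+1] n j ⟩
  suc n C suc j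
    ∎
  where
  open ≡-Reasoning
  down : ∀ a b → (+ 1 ℤ.+ a) ℤ.+ ℤ.- ((+ 1 ℤ.+ b) ℤ.+ (+ 1 ℤ.+ b)) ℤ.+ -[1+ 0 ] ≡ a ℤ.+ ℤ.- ((+ 1 ℤ.+ b) ℤ.+ (+ 1 ℤ.+ b))
  down = ℤSolver.solve-∀
  up : ∀ a b → (+ 1 ℤ.+ a) ℤ.+ ℤ.- ((+ 1 ℤ.+ b) ℤ.+ (+ 1 ℤ.+ b)) ℤ.+ + 1 ≡ a ℤ.+ ℤ.- (b ℤ.+ b)
  up = ℤSolver.solve-∀

length-balancedCols : ∀ h → length (balancedCols (h * 2)) ≡ (h * 2) C ⌊ h * 2 /2⌋
length-balancedCols h = begin
  length (balancedCols (h * 2))                      ≡⟨ length-filter zeroSum? (allVecs signs (h * 2)) ⟩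
  signCount (h * 2) (+ 0)                            ≡⟨ cong (signCount (h * 2)) middle ⟩
  signCount (h * 2) (+ (h * 2) ℤ.+ ℤ.- (+ h ℤ.+ + h)) ≡⟨ signCount-binomial (h * 2) h ⟩
  (h * 2) C h                                        ≡⟨ cong ((h * 2) C_) (sym (half h)) ⟩
  (h * 2) C ⌊ h * 2 /2⌋                              ∎
  where
  open ≡-Reasoning
  middle : + 0 ≡ + (h * 2) ℤ.+ ℤ.- (+ h ℤ.+ + h)
  middle = trans (sym (ℤₚ.+-inverseʳ (+ (h * 2)))) (cong (λ t → + (h * 2) ℤ.+ ℤ.- + t) (trans (ℕₚ.*-comm h 2) (cong (_+_ h) (ℕₚ.+-identityʳ h))))
  half : ∀ h → ⌊ h * 2 /2⌋ ≡ h
  half zero    = refl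
  half (suc h) = cong suc (half h)

-- there is a balanced column of every even length, e.g. (1, −1, 1, −1, …)
balancedCols-nonempty : ∀ h → 1 ≤ length (balancedCols (h * 2))
balancedCols-nonempty h = ∈ₚ.∈-length (∈ₚ.∈-filter⁺ zeroSum? {xs = allVecs signs (h * 2)}
  (∈-allVecs⁺ signs (h * 2) (alternating-signs h)) (alternating-sum h))
  where
  alternating : ∀ h → Vec ℤ (h * 2)
  alternating zero    = []
  alternating (suc h) = + 1 ∷ -[1+ 0 ] ∷ alternating h
  alternating-sum : ∀ h → vsum (alternating h) ≡ + 0
  alternating-sum zero    = refl
  alternating-sum (suc h) = cong (λ t → + 1 ℤ.+ (-[1+ 0 ] ℤ.+ t)) (alternating-sum h)
  alternating-signs : ∀ h → VecAll.All (_∈ signs) (alternating h)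
  alternating-signs zero    = []
  alternating-signs (suc h) = here refl ∷ there (here refl) ∷ alternating-signs h

-- Second moment: Σ_{w ∈ S^k} ‖colSum w‖² = k · m · |S|^k for the balanced columns S;
-- each new column adds m to every squared norm on average, by ∑-balanced-shift
secondMoment : ∀ m k → ∑ (allVecs (balancedCols m) k) (sqNorm ∘ colSum) ≡ k * (m * length (balancedCols m) ^ k)
secondMoment m zero    = zeros m
  where
  zeros : ∀ m → sqNorm (Vec.replicate m (+ 0)) + 0 ≡ 0
  zeros zero    = refl
  zeros (suc m) = zeros m
secondMoment m (suc k) = begin
  ∑ (allVecs S (suc k)) (sqNorm ∘ colSum)         ≡⟨ ∑-allVecs-suc S k _ ⟩
  ∑ S (λ c → ∑ W (λ w → sqNorm (c ⊞ colSum w)))   ≡⟨ ∑-swap S W _ ⟩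
  ∑ W (λ w → ∑ S (λ c → sqNorm (c ⊞ colSum w)))   ≡⟨ ∑-cong′ W (λ w → ∑-balanced-shift m (colSum w)) ⟩
  ∑ W (λ w → K * (m + sqNorm (colSum w)))         ≡⟨ sym (∑-*ˡ K W _) ⟩
  K * ∑ W (λ w → m + sqNorm (colSum w))           ≡⟨ cong (K *_) (∑-+ W _ _) ⟩
  K * (∑ W (λ _ → m) + ∑ W (sqNorm ∘ colSum))
    ≡⟨ cong₂ (λ a b → K * (a + b)) (trans (∑-const W m) (cong (_* m) (length-allVecs S k))) (secondMoment m k) ⟩
  K * (K ^ k * m + k * (m * K ^ k))               ≡⟨ regroup K (K ^ k) m k ⟩
  suc k * (m * (K * K ^ k))                       ∎
  where
  open ≡-Reasoning
  S : List (Vec ℤ m)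
  S = balancedCols m
  W : List (Vec (Vec ℤ m) k)
  W = allVecs S k
  K : ℕ
  K = length S
  regroup : ∀ K P m k → K * (P * m + k * (m * P)) ≡ suc k * (m * (K * P))
  regroup = solve-∀

lookup-transpose : ∀ {A : Set} {m n} (M : Vec (Vec A n) m) (j : Fin n) →
                   Vec.lookup (Vec.transpose M) j ≡ Vec.map (λ r → Vec.lookup r j) M
lookup-transpose     []         j = Vecₚ.lookup-replicate j []
lookup-transpose {A} {suc m} {n} (r ∷ M) j = begin
  Vec.lookup ((Vec.replicate n cons Vec.⊛ r) Vec.⊛ Vec.transpose M) j
    ≡⟨ Vecₚ.lookup-⊛ j (Vec.replicate n cons Vec.⊛ r) (Vec.transpose M) ⟩
  Vec.lookup (Vec.replicate n cons Vec.⊛ r) j (Vec.lookup (Vec.transpose M) j)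
    ≡⟨ cong₂ (λ f t → f t) (Vecₚ.lookup-⊛ j (Vec.replicate n cons) r) (lookup-transpose M j) ⟩
  Vec.lookup (Vec.replicate n cons) j (Vec.lookup r j) (Vec.map (λ r → Vec.lookup r j) M)
    ≡⟨ cong (λ f → f (Vec.lookup r j) (Vec.map (λ r → Vec.lookup r j) M)) (Vecₚ.lookup-replicate j cons) ⟩
  Vec.lookup r j ∷ Vec.map (λ r → Vec.lookup r j) M
    ∎
  where
  open ≡-Reasoning
  cons : A → Vec A m → Vec A (suc m)
  cons x xs = x ∷ xs

transpose-involutive : ∀ {A : Set} {m n} (M : Vec (Vec A n) m) → Vec.transpose (Vec.transpose M) ≡ M
transpose-involutive M = extensionality _ _ λ i → extensionality _ _ λ j → begin
  Vec.lookup (Vec.lookup (Vec.transpose (Vec.transpose M)) i) j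
    ≡⟨ cong (λ r → Vec.lookup r j) (lookup-transpose (Vec.transpose M) i) ⟩
  Vec.lookup (Vec.map (λ r → Vec.lookup r i) (Vec.transpose M)) j
    ≡⟨ Vecₚ.lookup-map j (λ r → Vec.lookup r i) (Vec.transpose M) ⟩
  Vec.lookup (Vec.lookup (Vec.transpose M) j) i
    ≡⟨ cong (λ r → Vec.lookup r i) (lookup-transpose M j) ⟩
  Vec.lookup (Vec.map (λ r → Vec.lookup r j) M) i
    ≡⟨ Vecₚ.lookup-map i (λ r → Vec.lookup r j) M ⟩
  Vec.lookup (Vec.lookup M i) j
    ∎
  where
  open ≡-Reasoning
  extensionality : ∀ {B : Set} {n} (u v : Vec B n) → (∀ i → Vec.lookup u i ≡ Vec.lookup v i) → u ≡ v
  extensionality u v u≗v = trans (sym (Vecₚ.tabulate∘lookup u)) (trans (Vecₚ.tabulate-cong u≗v) (Vecₚ.tabulate∘lookup v))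

rowSum : ∀ {m k} (w : Vec (Vec ℤ m) k) (j : Fin m) → vsum (Vec.map (λ c → Vec.lookup c j) w) ≡ Vec.lookup (colSum w) j
rowSum {m} []      j = sym (Vecₚ.lookup-replicate j (+ 0))
rowSum     (c ∷ w) j = trans (cong (ℤ._+_ (Vec.lookup c j)) (rowSum w j)) (sym (Vecₚ.lookup-zipWith ℤ._+_ j c (colSum w)))

row-negate : ∀ {m k} (w : Vec (Vec ℤ m) k) (j : Fin m) →
             Vec.map (λ c → Vec.lookup c j) (Vec.map negate w) ≡ negate (Vec.map (λ c → Vec.lookup c j) w)
row-negate []      j = refl
row-negate (c ∷ w) j = cong₂ _∷_ (Vecₚ.lookup-map j (λ x → ℤ.- x) c) (row-negate w j)

_≟ᵥ_ : ∀ {m} (u v : Vec ℤ m) → Dec (u ≡ v)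
_≟ᵥ_ = Vecₚ.≡-dec ℤ._≟_

-- Embedding: for k-tuples a, b of balanced columns with colSum a = colSum b, the
-- m × 2k matrix with columns a₁,…,a_k, −b₁,…,−b_k lies in A(m, 2k); distinct pairs
-- give distinct matrices, so the number of such pairs is at most α(m, 2k).
module Embedding (m k : ℕ) where

  S : List (Vec ℤ m)
  S = balancedCols m
  W : List (Vec (Vec ℤ m) k)
  W = allVecs S k

  Pair : Set
  Pair = Vec (Vec ℤ m) k × Vec (Vec ℤ m) k

  columns : Pair → Vec (Vec ℤ m) (k + k)
  columns (a , b) = a Vec.++ Vec.map negate b

  matrix : Pair → Vec (Vec ℤ (k + k)) m
  matrix p = Vec.transpose (columns p)

  matrix-injective : ∀ {p q} → matrix p ≡ matrix q → p ≡ q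
  matrix-injective {a , b} {a′ , b′} eq
    with Vecₚ.++-injective a a′ (trans (sym (transpose-involutive (columns (a , b))))
                                  (trans (cong Vec.transpose eq) (transpose-involutive (columns (a′ , b′)))))
  ... | refl , -b≡-b′ = cong (a ,_) (trans (sym (negate-all b)) (trans (cong (Vec.map negate) -b≡-b′) (negate-all b′)))
    where
    negate-all : ∀ {k} (b : Vec (Vec ℤ m) k) → Vec.map negate (Vec.map negate b) ≡ b
    negate-all []      = refl
    negate-all (c ∷ b) = cong₂ _∷_ (negate-involutive c) (negate-all b)

  sameSum? : (p : Pair) → Dec (colSum (proj₁ p) ≡ colSum (proj₂ p))
  sameSum? (a , b) = colSum a ≟ᵥ colSum b

  pairs : List Pair
  pairs = filter sameSum? (cartesianProduct W W)

  length-pairs : length pairs ≡ ∑ W (λ a → ∑ W (λ b → 𝟙 (colSum a ≟ᵥ colSum b)))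
  length-pairs = trans (length-filter sameSum? (cartesianProduct W W)) (∑-cartesianProduct W W _)

  columns-balanced : ∀ {a b} → a ∈ W → b ∈ W → VecAll.All BalancedCol (columns (a , b))
  columns-balanced a∈ b∈ = VecAllₚ.++⁺ (VecAll.map ∈-balancedCols⁻ (∈-allVecs⁻ S k a∈))
    (VecAllₚ.map⁺ (VecAll.map (negate-balanced ∘ ∈-balancedCols⁻) (∈-allVecs⁻ S k b∈)))

  matrix-∈A : ∀ {p} → p ∈ pairs → matrix p ∈ filter balanced? (allSignMatrices m (k + k))
  matrix-∈A {a , b} p∈ = ∈ₚ.∈-filter⁺ balanced? {xs = allSignMatrices m (k + k)} entries±1 (rows₀ , cols₀)
    where
    p∈pairs : (a , b) ∈ cartesianProduct W W × colSum a ≡ colSum b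
    p∈pairs = ∈ₚ.∈-filter⁻ sameSum? {xs = cartesianProduct W W} p∈
    a∈×b∈ : a ∈ W × b ∈ W
    a∈×b∈ = ∈ₚ.∈-cartesianProduct⁻ W W (proj₁ p∈pairs)
    Cs : Vec (Vec ℤ m) (k + k)
    Cs = columns (a , b)
    Cs-balanced : VecAll.All BalancedCol Cs
    Cs-balanced = columns-balanced (proj₁ a∈×b∈) (proj₂ a∈×b∈)
    small : ∀ {n} (v : Vec ℤ n) → vsum v ≡ + 0 → SmallSum v
    small v v₀ = subst (λ t → ∣ t ∣ ≤ 1) (sym v₀) z≤n
    entries±1 : matrix (a , b) ∈ allSignMatrices m (k + k)
    entries±1 = ∈-allVecs⁺ _ m (VecAllₚ.lookup⁻ (λ j →
      subst (_∈ allVecs signs (k + k)) (sym (lookup-transpose Cs j))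
        (∈-allVecs⁺ signs (k + k) (VecAllₚ.map⁺ (VecAll.map (λ c → VecAllₚ.lookup⁺ (proj₁ c) j) Cs-balanced)))))
    row₀ : ∀ j → vsum (Vec.map (λ c → Vec.lookup c j) Cs) ≡ + 0
    row₀ j = begin
      vsum (Vec.map (λ c → Vec.lookup c j) Cs)
        ≡⟨ cong vsum (Vecₚ.map-++ (λ c → Vec.lookup c j) a (Vec.map negate b)) ⟩
      vsum (Vec.map (λ c → Vec.lookup c j) a Vec.++ Vec.map (λ c → Vec.lookup c j) (Vec.map negate b))
        ≡⟨ vsum-++ (Vec.map (λ c → Vec.lookup c j) a) _ ⟩
      vsum (Vec.map (λ c → Vec.lookup c j) a) ℤ.+ vsum (Vec.map (λ c → Vec.lookup c j) (Vec.map negate b))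
        ≡⟨ cong (ℤ._+_ (vsum (Vec.map (λ c → Vec.lookup c j) a))) (trans (cong vsum (row-negate b j)) (vsum-negate (Vec.map (λ c → Vec.lookup c j) b))) ⟩
      vsum (Vec.map (λ c → Vec.lookup c j) a) ℤ.+ ℤ.- vsum (Vec.map (λ c → Vec.lookup c j) b)
        ≡⟨ cong₂ (λ x y → x ℤ.+ ℤ.- y) (rowSum a j) (rowSum b j) ⟩
      Vec.lookup (colSum a) j ℤ.+ ℤ.- Vec.lookup (colSum b) j
        ≡⟨ cong (λ t → Vec.lookup t j ℤ.+ ℤ.- Vec.lookup (colSum b) j) (proj₂ p∈pairs) ⟩
      Vec.lookup (colSum b) j ℤ.+ ℤ.- Vec.lookup (colSum b) j
        ≡⟨ ℤₚ.+-inverseʳ (Vec.lookup (colSum b) j) ⟩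
      + 0
        ∎
      where open ≡-Reasoning
    rows₀ : VecAll.All SmallSum (matrix (a , b))
    rows₀ = VecAllₚ.lookup⁻ (λ j → subst (SmallSum {k + k}) (sym (lookup-transpose Cs j)) (small (Vec.map (λ c → Vec.lookup c j) Cs) (row₀ j)))
    cols₀ : VecAll.All SmallSum (Vec.transpose (matrix (a , b)))
    cols₀ = subst (VecAll.All (SmallSum {m})) (sym (transpose-involutive Cs)) (VecAll.map (λ {c} c-bal → small c (proj₂ c-bal)) Cs-balanced)

  pairs≤α : length pairs ≤ α m (k + k)
  pairs≤α = subst (_≤ α m (k + k)) (Listₚ.length-map matrix pairs)
    (unique-length≤ (List.map matrix pairs) _ matrices-unique (All.tabulate in-A))
    where
    S-unique : Unique S
    S-unique = Uniqueₚ.filter⁺ zeroSum? (allVecs-unique signs m (((λ ()) ∷ []) ∷ [] ∷ []))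
    matrices-unique : Unique (List.map matrix pairs)
    matrices-unique = Uniqueₚ.map⁺ matrix-injective
      (Uniqueₚ.filter⁺ sameSum? (Uniqueₚ.cartesianProduct⁺ (allVecs-unique S k S-unique) (allVecs-unique S k S-unique)))
    in-A : ∀ {M} → M ∈ List.map matrix pairs → M ∈ filter balanced? (allSignMatrices m (k + k))
    in-A M∈ with ∈ₚ.∈-map⁻ matrix M∈
    ... | p , p∈ , refl = matrix-∈A p∈

digits-injective : ∀ b d d′ q q′ → d < b → d′ < b → d + b * q ≡ d′ + b * q′ → d ≡ d′ × q ≡ q′
digits-injective b@(suc _) d d′ q q′ d<b d′<b eq =
  d≡d′ , ℕₚ.*-cancelˡ-≡ q q′ b (ℕₚ.+-cancelˡ-≡ d _ _ (trans eq (cong (λ t → t + b * q′) (sym d≡d′))))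
  where
  eq′ : d + q * b ≡ d′ + q′ * b
  eq′ = trans (cong (_+_ d) (ℕₚ.*-comm q b)) (trans eq (cong (_+_ d′) (ℕₚ.*-comm b q′)))
  d≡d′ : d ≡ d′
  d≡d′ = begin
    d                ≡⟨ sym (m<n⇒m%n≡m d<b) ⟩
    d % b            ≡⟨ sym ([m+kn]%n≡m%n d q b) ⟩
    (d + q * b) % b  ≡⟨ cong (_% b) eq′ ⟩
    (d′ + q′ * b) % b ≡⟨ [m+kn]%n≡m%n d′ q′ b ⟩
    d′ % b           ≡⟨ m<n⇒m%n≡m d′<b ⟩
    d′               ∎
    where open ≡-Reasoning

-- Integer vectors with all entries in [−s, s] are coded injectively by numbers
-- below (2s+1)ⁿ, reading the entries as digits in base 2s+1.
module BoxCode (s : ℕ) where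

  base : ℕ
  base = suc (s + s)

  Small : ℤ → Set
  Small y = ∣ y ∣ ≤ s

  digit : ℤ → ℕ
  digit (+ a)    = a
  digit -[1+ a ] = s + suc a

  digit-< : ∀ y → Small y → digit y < base
  digit-< (+ a)    a≤s = s≤s (ℕₚ.≤-trans a≤s (ℕₚ.m≤m+n s s))
  digit-< -[1+ a ] a<s = s≤s (ℕₚ.+-monoʳ-≤ s a<s)

  negative-digit : ∀ a → suc s ≤ s + suc a
  negative-digit a = subst (suc s ≤_) (sym (ℕₚ.+-suc s a)) (s≤s (ℕₚ.m≤m+n s a))

  digit-injective : ∀ y y′ → Small y → Small y′ → digit y ≡ digit y′ → y ≡ y′
  digit-injective (+ a)    (+ b)     _   _   refl = refl
  digit-injective (+ a)    -[1+ b ]  a≤s _   a≡   = ⊥-elim (ℕₚ.<⇒≱ (subst (suc s ≤_) (sym a≡) (negative-digit b)) a≤s)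
  digit-injective -[1+ a ] (+ b)     _   b≤s ≡b   = ⊥-elim (ℕₚ.<⇒≱ (subst (suc s ≤_) ≡b (negative-digit a)) b≤s)
  digit-injective -[1+ a ] -[1+ b ]  _   _   eq   = cong -[1+_] (ℕₚ.suc-injective (ℕₚ.+-cancelˡ-≡ s _ _ eq))

  code : ∀ {n} → Vec ℤ n → ℕ
  code []      = 0
  code (y ∷ v) = digit y + base * code v

  code-< : ∀ {n} (v : Vec ℤ n) → VecAll.All Small v → code v < base ^ n
  code-< []      []           = s≤s z≤n
  code-< {suc n} (y ∷ v) (y≤s ∷ v≤s) = ℕₚ.≤-trans (ℕₚ.+-monoˡ-≤ (base * code v) (digit-< y y≤s))
    (subst (_≤ base * base ^ n) (ℕₚ.*-suc base (code v)) (ℕₚ.*-monoʳ-≤ base (code-< v v≤s)))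

  code-injective : ∀ {n} (u v : Vec ℤ n) → VecAll.All Small u → VecAll.All Small v → code u ≡ code v → u ≡ v
  code-injective []      []      _            _            _  = refl
  code-injective (x ∷ u) (y ∷ v) (x≤s ∷ u≤s) (y≤s ∷ v≤s) eq
    with digits-injective base (digit x) (digit y) (code u) (code v) (digit-< x x≤s) (digit-< y y≤s) eq
  ... | x≡y , u≡v = cong₂ _∷_ (digit-injective x y x≤s y≤s x≡y) (code-injective u v u≤s v≤s u≡v)

-- the arithmetic of Markov's inequality: if T·Q ≤ Q·g + M and 2M ≤ T·Q then T ≤ 2g
markov-arithmetic : ∀ T Q g M .{{_ : NonZero Q}} → T * Q ≤ Q * g + M → 2 * M ≤ T * Q → T ≤ 2 * g
markov-arithmetic T Q g M TQ≤ 2M≤TQ =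
  ℕₚ.*-cancelˡ-≤ Q (subst₂ _≤_ (ℕₚ.*-comm T Q) (swap Q g) (ℕₚ.+-cancelʳ-≤ (T * Q) (T * Q) (2 * (Q * g)) doubled))
  where
  open ℕₚ.≤-Reasoning
  swap : ∀ Q g → 2 * (Q * g) ≡ Q * (2 * g)
  swap = solve-∀
  doubled : T * Q + T * Q ≤ 2 * (Q * g) + T * Q
  doubled = begin
    T * Q + T * Q          ≡⟨ cong (_+_ (T * Q)) (sym (ℕₚ.+-identityʳ (T * Q))) ⟩
    2 * (T * Q)            ≤⟨ ℕₚ.*-monoʳ-≤ 2 TQ≤ ⟩
    2 * (Q * g + M)        ≡⟨ ℕₚ.*-distribˡ-+ 2 (Q * g) M ⟩
    2 * (Q * g) + 2 * M    ≤⟨ ℕₚ.+-monoʳ-≤ (2 * (Q * g)) 2M≤TQ ⟩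
    2 * (Q * g) + T * Q    ∎

module GoodTuples (m′ k s : ℕ) where
  open BoxCode s

  m : ℕ
  m = suc m′
  S : List (Vec ℤ m)
  S = balancedCols m
  W : List (Vec (Vec ℤ m) k)
  W = allVecs S k
  K : ℕ
  K = length S

  -- the row-sum vector without its first entry; it determines the whole row-sum vector
  rest : Vec (Vec ℤ m) k → Vec ℤ m′
  rest w = Vec.tail (colSum w)

  good? : (w : Vec (Vec ℤ m) k) → Dec (VecAll.All Small (rest w))
  good? w = VecAll.all? (λ y → ∣ y ∣ ≤? s) (rest w)

  good : List (Vec (Vec ℤ m) k)
  good = filter good? W

  ∈-good⁻ : ∀ {w} → w ∈ good → w ∈ W × VecAll.All Small (rest w)
  ∈-good⁻ = ∈ₚ.∈-filter⁻ good? {xs = W}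

  -- Markov's inequality for ‖colSum w‖²: if m·2k ≤ (s+1)², at least half of all tuples are good
  half-good : m * (k + k) ≤ suc s * suc s → K ^ k ≤ 2 * length good
  half-good 2km≤Q = markov-arithmetic (K ^ k) Q (length good) (k * (m * K ^ k)) summed bound
    where
    Q : ℕ
    Q = suc s * suc s
    -- a bad tuple has ‖colSum w‖² ≥ ‖rest w‖² ≥ (s+1)²
    pointwise : ∀ w → Q ≤ Q * 𝟙 (good? w) + sqNorm (colSum w)
    pointwise w with good? w
    ... | yes _   = ℕₚ.≤-trans (ℕₚ.≤-reflexive (sym (ℕₚ.*-identityʳ Q))) (ℕₚ.m≤m+n _ _)
    ... | no  bad = ℕₚ.≤-trans (ℕₚ.≤-trans (sqNorm-large s (rest w) bad) (sqNorm-tail (colSum w))) (ℕₚ.m≤n+m _ _)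
    summed : K ^ k * Q ≤ Q * length good + k * (m * K ^ k)
    summed = subst₂ _≤_
      (trans (∑-const W Q) (cong (_* Q) (length-allVecs S k)))
      (trans (∑-+ W _ _) (cong₂ _+_ (trans (sym (∑-*ˡ Q W _)) (cong (Q *_) (sym (length-filter good? W)))) (secondMoment m k)))
      (∑-mono (All.universal pointwise W))
    bound : 2 * (k * (m * K ^ k)) ≤ K ^ k * Q
    bound = subst (_≤ K ^ k * Q) (regroup k m (K ^ k)) (ℕₚ.*-monoʳ-≤ (K ^ k) 2km≤Q)
      where
      regroup : ∀ k m T → T * (m * (k + k)) ≡ 2 * (k * (m * T))
      regroup = solve-∀

  same-code : ∀ {a b} → a ∈ good → b ∈ good → δ (code (rest a)) (code (rest b)) ≤ 𝟙 (colSum a ≟ᵥ colSum b)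
  same-code {a} {b} a∈ b∈ with code (rest a) ≟ code (rest b)
  ... | no  _  = z≤n
  ... | yes eq with colSum a ≟ᵥ colSum b
  ...   | yes _  = ℕₚ.≤-refl
  ...   | no  ne = ⊥-elim (ne (zero-sum-tail-injective (colSum a) (colSum b) (zero-sum a∈) (zero-sum b∈)
                     (code-injective (rest a) (rest b) (proj₂ (∈-good⁻ a∈)) (proj₂ (∈-good⁻ b∈)) eq)))
    where
    zero-sum : ∀ {w} → w ∈ good → vsum (colSum w) ≡ + 0
    zero-sum w∈ = vsum-colSum _ (VecAll.map (proj₂ ∘ ∈-balancedCols⁻) (∈-allVecs⁻ S k (proj₁ (∈-good⁻ w∈))))

  code-coincidences≤ : ∑ good (λ a → ∑ good (λ b → δ (code (rest a)) (code (rest b))))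
                         ≤ ∑ W (λ a → ∑ W (λ b → 𝟙 (colSum a ≟ᵥ colSum b)))
  code-coincidences≤ = ℕₚ.≤-trans
    (∑-mono (All.tabulate (λ {a} a∈ → ℕₚ.≤-trans (∑-mono (All.tabulate (λ {b} b∈ → same-code a∈ b∈))) (∑-filter≤ good? W _))))
    (∑-filter≤ good? W _)

  -- the codes of good tuples lie below (2s+1)^(m−1), so by the collision bound
  -- (#good)² ≤ (2s+1)^(m−1) · #{(a,b) ∈ S^k × S^k : colSum a = colSum b}
  good-collisions : length good * length good ≤ base ^ m′ * ∑ W (λ a → ∑ W (λ b → 𝟙 (colSum a ≟ᵥ colSum b)))
  good-collisions = ℕₚ.≤-trans
    (collision-bound good (code ∘ rest) (base ^ m′) (All.tabulate (λ {w} w∈ → code-< (rest w) (proj₂ (∈-good⁻ w∈)))))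
    (ℕₚ.*-monoʳ-≤ (base ^ m′) code-coincidences≤)

isqrt : ∀ x → Σ ℕ λ s → s * s ≤ x × x < suc s * suc s
isqrt zero    = 0 , z≤n , s≤s z≤n
isqrt (suc x) with isqrt x
... | s , s²≤x , x<[s+1]² with ℕₚ.m≤n⇒m<n∨m≡n x<[s+1]²
...   | inj₁ 1+x<[s+1]² = s , ℕₚ.m≤n⇒m≤1+n s²≤x , 1+x<[s+1]²
...   | inj₂ 1+x≡[s+1]² = suc s , ℕₚ.≤-reflexive (sym 1+x≡[s+1]²) ,
          subst (_< suc (suc s) * suc (suc s)) (sym 1+x≡[s+1]²) (ℕₚ.*-mono-< (ℕₚ.n<1+n (suc s)) (ℕₚ.n<1+n (suc s)))

box-size : ∀ x → 1 ≤ x → BoxCode.base (proj₁ (isqrt x)) * BoxCode.base (proj₁ (isqrt x)) ≤ 9 * x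
box-size x 1≤x with isqrt x
... | zero  , _    , x<1 = ⊥-elim (ℕₚ.<⇒≱ x<1 1≤x)
... | suc t , s²≤x , _   = ℕₚ.≤-trans [2s+1]²≤9s² (ℕₚ.*-monoʳ-≤ 9 s²≤x)
  where
  expand : ∀ t → 9 * (suc t * suc t) ≡ suc (suc t + suc t) * suc (suc t + suc t) + (5 * (t * t) + 6 * t)
  expand = solve-∀
  [2s+1]²≤9s² : suc (suc t + suc t) * suc (suc t + suc t) ≤ 9 * (suc t * suc t)
  [2s+1]²≤9s² = subst (suc (suc t + suc t) * suc (suc t + suc t) ≤_) (sym (expand t)) (ℕₚ.m≤m+n _ (5 * (t * t) + 6 * t))

^-distribʳ-* : ∀ a b e → (a * b) ^ e ≡ a ^ e * b ^ e
^-distribʳ-* a b zero    = refl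
^-distribʳ-* a b (suc e) = trans (cong (a * b *_) (^-distribʳ-* a b e)) (interchange a b (a ^ e) (b ^ e))
  where
  interchange : ∀ a b x y → a * b * (x * y) ≡ a * x * (b * y)
  interchange = solve-∀

boxes-squared : ∀ a b e → 1 ≤ a * b → let R = BoxCode.base (proj₁ (isqrt (a * b))) ^ e in R * R ≤ (9 * a) ^ e * b ^ e
boxes-squared a b e 1≤ab = begin
  B ^ e * B ^ e        ≡⟨ sym (^-distribʳ-* B B e) ⟩
  (B * B) ^ e          ≤⟨ ℕₚ.^-monoˡ-≤ e (box-size (a * b) 1≤ab) ⟩
  (9 * (a * b)) ^ e    ≡⟨ cong (_^ e) (sym (ℕₚ.*-assoc 9 a b)) ⟩
  (9 * a * b) ^ e      ≡⟨ ^-distribʳ-* (9 * a) b e ⟩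
  (9 * a) ^ e * b ^ e  ∎
  where
  open ℕₚ.≤-Reasoning
  B : ℕ
  B = BoxCode.base (proj₁ (isqrt (a * b)))

power-four : ∀ K k → (K ^ k * K ^ k) * (K ^ k * K ^ k) ≡ K ^ (2 * (k * 2))
power-four K k = trans (fourth (K ^ k)) (trans (ℕₚ.^-*-assoc K k 4) (cong (K ^_) (twice k)))
  where
  fourth : ∀ T → (T * T) * (T * T) ≡ T * (T * (T * (T * 1)))
  fourth = solve-∀
  twice : ∀ k → k * 4 ≡ 2 * (k * 2)
  twice = solve-∀

core-estimate : ∀ m′ k s → suc m′ * (k + k) ≤ suc s * suc s →
                length (balancedCols (suc m′)) ^ k * length (balancedCols (suc m′)) ^ k
                  ≤ 4 * (BoxCode.base s ^ m′ * α (suc m′) (k + k))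
core-estimate m′ k s markov-condition = begin
  T * T                  ≤⟨ ℕₚ.*-mono-≤ (half-good markov-condition) (half-good markov-condition) ⟩
  (2 * g) * (2 * g)      ≡⟨ square g ⟩
  4 * (g * g)            ≤⟨ ℕₚ.*-monoʳ-≤ 4 good-collisions ⟩
  4 * (R * ∑ W (λ a → ∑ W (λ b → 𝟙 (colSum a ≟ᵥ colSum b))))
                         ≡⟨ cong (λ t → 4 * (R * t)) (sym length-pairs) ⟩
  4 * (R * length pairs) ≤⟨ ℕₚ.*-monoʳ-≤ 4 (ℕₚ.*-monoʳ-≤ R pairs≤α) ⟩
  4 * (R * α (suc m′) (k + k)) ∎
  where
  open ℕₚ.≤-Reasoning
  open GoodTuples m′ k s using (W; half-good; good; good-collisions)
  open Embedding (suc m′) k using (pairs; length-pairs; pairs≤α)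
  T : ℕ
  T = length (balancedCols (suc m′)) ^ k
  g : ℕ
  g = length good
  R : ℕ
  R = BoxCode.base s ^ m′
  square : ∀ g → (2 * g) * (2 * g) ≡ 4 * (g * g)
  square = solve-∀

squaring : ∀ T R A c P → 1 ≤ T → T * T ≤ 4 * (R * A) → R * R ≤ c * P → (T * T) * (T * T) < 32 * c * (A * A) * P
squaring T R A c P 1≤T T²≤4RA R²≤cP = subst ((T * T) * (T * T) <_) (double c P A) (ℕₚ.+-mono-≤ 1≤X T⁴≤X)
  where
  open ℕₚ.≤-Reasoning
  regroup : ∀ R A → 4 * (R * A) * (4 * (R * A)) ≡ 16 * (R * R) * (A * A)
  regroup = solve-∀
  double : ∀ c P A → 16 * (c * P) * (A * A) + 16 * (c * P) * (A * A) ≡ 32 * c * (A * A) * P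
  double = solve-∀
  X : ℕ
  X = 16 * (c * P) * (A * A)
  T⁴≤X : (T * T) * (T * T) ≤ X
  T⁴≤X = begin
    (T * T) * (T * T)            ≤⟨ ℕₚ.*-mono-≤ T²≤4RA T²≤4RA ⟩
    4 * (R * A) * (4 * (R * A))  ≡⟨ regroup R A ⟩
    16 * (R * R) * (A * A)       ≤⟨ ℕₚ.*-monoˡ-≤ (A * A) (ℕₚ.*-monoʳ-≤ 16 R²≤cP) ⟩
    X                            ∎
  1≤X : 1 ≤ X
  1≤X = ℕₚ.≤-trans (ℕₚ.*-mono-≤ (ℕₚ.*-mono-≤ 1≤T 1≤T) (ℕₚ.*-mono-≤ 1≤T 1≤T)) T⁴≤X

main-estimate : ∀ h′ k′ → let m = suc h′ * 2 ; n = suc k′ * 2 in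
                1 * ((m C ⌊ m /2⌋) ^ (2 * n)) < 32 * (9 * m) ^ (m ∸ 1) * (α m n ^ 2) * (n ^ (m ∸ 1))
main-estimate h′ k′ = subst₂ _<_ T⁴≡ A*A≡ (squaring T R A c P 1≤T T²≤4RA R²≤cP)
  where
  m′ : ℕ
  m′ = suc (h′ * 2)
  m  : ℕ
  m  = suc m′
  k  : ℕ
  k  = suc k′
  n  : ℕ
  n  = k * 2
  s  : ℕ
  s  = proj₁ (isqrt (m * n))
  K  : ℕ
  K  = length (balancedCols m)
  T  : ℕ
  T  = K ^ k
  R  : ℕ
  R  = BoxCode.base s ^ m′
  A  : ℕ
  A  = α m n
  c  : ℕ
  c  = (9 * m) ^ m′
  P  : ℕ
  P  = n ^ m′

  k+k≡n : k + k ≡ n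
  k+k≡n = trans (cong (_+_ k) (sym (ℕₚ.+-identityʳ k))) (ℕₚ.*-comm 2 k)

  markov-condition : m * (k + k) ≤ suc s * suc s
  markov-condition = subst (λ t → m * t ≤ suc s * suc s) (sym k+k≡n) (ℕₚ.<⇒≤ (proj₂ (proj₂ (isqrt (m * n)))))

  T²≤4RA : T * T ≤ 4 * (R * A)
  T²≤4RA = subst (λ t → T * T ≤ 4 * (R * α m t)) k+k≡n (core-estimate m′ k s markov-condition)

  R²≤cP : R * R ≤ c * P
  R²≤cP = boxes-squared m n m′ (s≤s z≤n)

  1≤T : 1 ≤ T
  1≤T = subst (_≤ T) (ℕₚ.^-zeroˡ k) (ℕₚ.^-monoˡ-≤ k (balancedCols-nonempty (suc h′)))

  T⁴≡ : (T * T) * (T * T) ≡ 1 * ((m C ⌊ m /2⌋) ^ (2 * n))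
  T⁴≡ = trans (power-four K k) (trans (cong (_^ (2 * n)) (length-balancedCols (suc h′))) (sym (ℕₚ.*-identityˡ _)))

  A*A≡ : 32 * c * (A * A) * P ≡ 32 * (9 * m) ^ (m ∸ 1) * (A ^ 2) * (n ^ (m ∸ 1))
  A*A≡ = cong (λ t → 32 * c * (A * t) * P) (sym (ℕₚ.*-identityʳ A))

theorem8 : (m : ℕ) → 0 < m → 2 ∣ m →
    Σ ℕ λ p → Σ ℕ λ q → Σ ℕ λ N →
    0 < p × 0 < q ×
    ((n : ℕ) → 2 ∣ n → N ≤ n →
    p * ((m C ⌊ m /2⌋) ^ (2 * n)) < q * (α m n ^ 2) * (n ^ (m ∸ 1)))
theorem8 _ () (divides zero refl)
theorem8 m _  (divides (suc h′) refl) =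
  1 , 32 * (9 * m) ^ (m ∸ 1) , 1 , s≤s z≤n , ℕₚ.≤-trans (ℕₚ.m^n>0 (9 * m) (m ∸ 1)) (ℕₚ.m≤m+n _ _) , estimate
  where
  estimate : (n : ℕ) → 2 ∣ n → 1 ≤ n → 1 * ((m C ⌊ m /2⌋) ^ (2 * n)) < 32 * (9 * m) ^ (m ∸ 1) * (α m n ^ 2) * (n ^ (m ∸ 1))
  estimate _ (divides zero    refl) ()
  estimate _ (divides (suc k′) refl) _ = main-estimate h′ k′
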